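{- (i) For every monotonic GNN $\mathcal{N}$ and all pointed graphs $(G,v)$, $(G',v')$ of its dimension, if there is an injective homomorphism from $(G,v)$ to $(G',v')$ and $\mathcal{N}(G,v)=\mathsf{true}$, then $\mathcal{N}(G',v')=\mathsf{true}$. (ii) There exist a monotonic GNN $\mathcal{N}$ and pointed graphs $(G,v)$, $(G',v')$ such that there is a homomorphism from $(G,v)$ to $(G',v')$, $\mathcal{N}(G,v)=\mathsf{true}$ and $\mathcal{N}(G',v')=\mathsf{false}$.
   Context: Graphs are finite, undirected, simple, node-labelled $G=(V,E,\lambda)$ with $\lambda:V\to\{0,1\}^d$; a pointed graph is $(G,v)$, $v\in V$. A homomorphism from $(G,v)$ to $(G',v')$, $G'=(V',E',\lambda')$, is a map $h:V\to V'$ with $h(v)=v'$ such that $\{u,w\}\in E$ implies $\{h(u),h(w)\}\in E'$ and, for each $i$, if the $i$-th entry of $\lambda(u)$ is $1$ then so is the $i$-th entry of $\lambda'(h(u))$; it is injective if $h$ is. A GNN of dimension $d$ with $L$ layers consists of layers $(\mathsf{agg}_\ell,\mathsf{comb}_\ell)$, where $\mathsf{agg}_\ell$ maps finite multisets of vectors to vectors and $\mathsf{comb}_\ell$ maps vectors to vectors (with compatible dimensions, first input dimension $d$), and a classification function $\mathsf{cls}$ from vectors to $\{\mathsf{false},\mathsf{true}\}$. On $G$: $\lambda^{(0)}=\lambda$, $\lambda^{(\ell)}(v)=\mathsf{comb}_\ell(\lambda^{(\ell-1)}(v),\mathsf{agg}_\ell(\{\!\{\lambda^{(\ell-1)}(w):\{v,w\}\in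 E\}\!\}))$, $\mathcal{N}(G,v)=\mathsf{cls}(\lambda^{(L)}(v))$. Order: vectors componentwise; multisets $M\le M'$ iff there is an injection $f:M\to M'$ with $\mathbf{x}\le f(\mathbf{x})$ for all $\mathbf{x}\in M$; $\mathsf{false}\le\mathsf{true}$. A function is non-decreasing if $x\le y$ implies $f(x)\le f(y)$. A GNN is monotonic if all its aggregation functions, combination functions and its classification function are non-decreasing.
   Formalization: The vectors on which the GNN's aggregation, combination and classification functions act have entries in ℚ rather than ℝ, in both part (i) and part (ii). -}

module Defs where

open import Data.Nat using (ℕ)
open import Data.Bool using (Bool; true; false; if_then_else_) renaming (_≤_ to _≤𝔹_)
open import Data.Fin using (Fin)
open import Data.List using (List; []; _∷_; length; map; allFin)
import Data.List as List
open import Data.Vec using (Vec; lookup)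
import Data.Vec as Vec
open import Data.Rational using (ℚ; 0ℚ; 1ℚ) renaming (_≤_ to _≤ℚ_)
open import Data.Product using (Σ; _×_)
open import Function.Definitions using (Injective)
open import Relation.Binary.PropositionalEquality using (_≡_)
open import Data.List.Relation.Binary.Permutation.Propositional using (_↭_)

record Graph (d : ℕ) : Set where
  field
    n      : ℕ
    adj    : Fin n → Fin n → Bool
    sym    : ∀ u w → adj u w ≡ adj w u
    irrefl : ∀ u → adj u u ≡ false
    label  : Fin n → Vec Bool d
open Graph public

IsHom : ∀ {d} (G G' : Graph d) → Fin (n G) → Fin (n G') → (Fin (n G) → Fin (n G')) → Set
IsHom G G' v v' h =
  (h v ≡ v')
  × (∀ u w → adj G u w ≡ true → adj G' (h u) (h w) ≡ true)
  × (∀ u i → lookup (label G u) i ≡ true → lookup (label G' (h u)) i ≡ true)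

Hom : ∀ {d} (G G' : Graph d) → Fin (n G) → Fin (n G') → Set
Hom G G' v v' = Σ (Fin (n G) → Fin (n G')) λ h → IsHom G G' v v' h

InjHom : ∀ {d} (G G' : Graph d) → Fin (n G) → Fin (n G') → Set
InjHom G G' v v' = Σ (Fin (n G) → Fin (n G')) λ h → IsHom G G' v v' h × Injective _≡_ _≡_ h

Vecℚ : ℕ → Set
Vecℚ = Vec ℚ

_≤V_ : ∀ {m} → Vecℚ m → Vecℚ m → Set
x ≤V y = ∀ i → lookup x i ≤ℚ lookup y i

-- M ≤ M' iff there is an injection f : M → M' with x ≤ f x for all x ∈ M
-- (elements of a multiset represented by positions in a list).
_≤M_ : ∀ {m} → List (Vecℚ m) → List (Vecℚ m) → Set
xs ≤M ys = Σ (Fin (length xs) → Fin (length ys)) λ f →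
  Injective _≡_ _≡_ f × (∀ i → List.lookup xs i ≤V List.lookup ys (f i))

-- One GNN layer from dimension m to dimension k: an aggregation function on
-- finite multisets of m-vectors (a function on lists invariant under
-- permutation) with output dimension a, and a combination function taking
-- (own vector, aggregated vector) to a k-vector.
record Layer (m k : ℕ) : Set where
  field
    a       : ℕ
    agg     : List (Vecℚ m) → Vecℚ a
    agg-perm : ∀ xs ys → xs ↭ ys → agg xs ≡ agg ys
    comb    : Vecℚ m → Vecℚ a → Vecℚ k
open Layer public

data Layers : ℕ → ℕ → Set where
  []  : ∀ {m} → Layers m m
  _∷_ : ∀ {m k j} → Layer m k → Layers k j → Layers m j

record GNN (d : ℕ) : Set where
  field
    out    : ℕ
    layers : Layers d out
    cls    : Vecℚ out → Bool
open GNN public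

MonoLayer : ∀ {m k} → Layer m k → Set
MonoLayer l =
  (∀ xs ys → xs ≤M ys → agg l xs ≤V agg l ys)
  × (∀ x x' y y' → x ≤V x' → y ≤V y' → comb l x y ≤V comb l x' y')

MonoLayers : ∀ {m k} → Layers m k → Set
MonoLayers []       = Data.Unit.⊤ where import Data.Unit
MonoLayers (l ∷ ls) = MonoLayer l × MonoLayers ls

Monotonic : ∀ {d} → GNN d → Set
Monotonic N = MonoLayers (layers N) × (∀ x y → x ≤V y → cls N x ≤𝔹 cls N y)

neighbours : ∀ {k} → (Fin k → Fin k → Bool) → Fin k → List (Fin k)
neighbours {k} e v = List.filterᵇ (e v) (allFin k)

runLayer : ∀ {d m k} (G : Graph d) → Layer m k → (Fin (n G) → Vecℚ m) → (Fin (n G) → Vecℚ k)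
runLayer G l f v = comb l (f v) (agg l (map f (neighbours (adj G) v)))

runLayers : ∀ {d m k} (G : Graph d) → Layers m k → (Fin (n G) → Vecℚ m) → (Fin (n G) → Vecℚ k)
runLayers G []       f = f
runLayers G (l ∷ ls) f = runLayers G ls (runLayer G l f)

initFeat : ∀ {d} (G : Graph d) → Fin (n G) → Vecℚ d
initFeat G u = Vec.map (λ b → if b then 1ℚ else 0ℚ) (label G u)

eval : ∀ {d} → GNN d → (G : Graph d) → Fin (n G) → Bool
eval N G v = cls N (runLayers G (layers N) (initFeat G) v)

-- Along an injective homomorphism h, the neighbour multiset of u embeds injectively into that
-- of h u, so by induction on the layers every feature vector of u is componentwise below the one
-- of h u once monotone aggregation and combination are applied; a monotone classifier then keeps
-- true. Without injectivity neighbours may be merged: a star with two leaves maps onto a single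
-- edge, and a monotone GNN testing "at least two neighbours" accepts the centre of the first but
-- not of the second.
module Submission where

open import Defs hiding (sym)
open import Data.Nat using (ℕ; zero; suc) renaming (_≤?_ to _≤ℕ?_)
open import Data.Nat.Properties using () renaming (≤-trans to ≤ℕ-trans)
open import Data.Bool using (Bool; true; false; if_then_else_; b≤b; f≤t) renaming (_≤_ to _≤𝔹_)
open import Data.Bool.Properties using (T?; T-≡; ≤-minimum)
open import Data.Fin using (Fin; zero; suc; cast)
open import Data.Fin.Properties using (cast-involutive; injective⇒≤)
open import Data.Product using (Σ; _×_; _,_; proj₂)
open import Data.List using (List; []; _∷_; length; map; allFin)
import Data.List as List
open import Data.List.Properties using (length-map)
open import Data.List.Membership.Propositional using (_∈_)
open import Data.List.Membership.Propositional.Properties using (∈-allFin; ∈-lookup; ∈-filter⁺; ∈-filter⁻)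
open import Data.List.Relation.Unary.Any using (index)
open import Data.List.Relation.Unary.Any.Properties using (lookup-index)
open import Data.List.Relation.Unary.All using () renaming (lookup to All-lookup)
open import Data.List.Relation.Unary.AllPairs using (_∷_)
open import Data.List.Relation.Unary.Unique.Propositional using (Unique)
open import Data.List.Relation.Unary.Unique.Propositional.Properties using (filter⁺; allFin⁺)
open import Data.List.Relation.Binary.Permutation.Propositional.Properties using (↭-length)
open import Data.Vec using ([]; _∷_; lookup)
import Data.Vec as Vec
import Data.Vec.Properties as Vec
open import Data.Rational using (ℚ; 0ℚ; 1ℚ) renaming (_≤_ to _≤ℚ_)
open import Data.Rational.Properties using (nonNegative⁻¹)
  renaming (≤-refl to ≤ℚ-refl; ≤-trans to ≤ℚ-trans; _≤?_ to _≤ℚ?_)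
open import Data.Empty using (⊥-elim)
open import Data.Unit using (tt)
open import Function using (_∘_; Equivalence)
open import Function.Definitions using (Injective)
open import Function.Construct.Composition using (injective)
open import Relation.Nullary using (Dec; does; yes; no)
open import Relation.Binary.PropositionalEquality using (_≡_; refl; sym; trans; cong; subst₂; module ≡-Reasoning)

private
  variable
    A B : Set
    m k : ℕ

≤𝔹-true : ∀ {a b} → a ≤𝔹 b → a ≡ true → b ≡ true
≤𝔹-true b≤b a≡true = a≡true

≡true⇒≤𝔹 : ∀ {a b} → (a ≡ true → b ≡ true) → a ≤𝔹 b
≡true⇒≤𝔹 {false} {b} _ = ≤-minimum b
≡true⇒≤𝔹 {true}      a⇒b with a⇒b refl
... | refl = b≤b

does-mono : ∀ {P Q : Set} (P? : Dec P) (Q? : Dec Q) → (P → Q) → does P? ≤𝔹 does Q?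
does-mono (no _)  (no _)  _   = b≤b
does-mono (no _)  (yes _) _   = f≤t
does-mono (yes _) (yes _) _   = b≤b
does-mono (yes p) (no ¬q) p⇒q = ⊥-elim (¬q (p⇒q p))

bit : Bool → ℚ
bit b = if b then 1ℚ else 0ℚ

bit-mono : ∀ {a b} → a ≤𝔹 b → bit a ≤ℚ bit b
bit-mono b≤b = ≤ℚ-refl
bit-mono f≤t = nonNegative⁻¹ 1ℚ

cast-injective : ∀ .(eq : m ≡ k) → Injective _≡_ _≡_ (cast eq)
cast-injective eq {i} {j} ci≡cj =
  trans (sym (cast-involutive _ eq i)) (trans (cong (cast (sym eq)) ci≡cj) (cast-involutive _ eq j))

lookup-map : ∀ (f : A → B) xs i → List.lookup (map f xs) i ≡ f (List.lookup xs (cast (length-map f xs) i))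
lookup-map f (x ∷ xs) zero    = refl
lookup-map f (x ∷ xs) (suc i) = lookup-map f xs i

lookup-injective : ∀ {xs : List A} → Unique xs → Injective _≡_ _≡_ (List.lookup xs)
lookup-injective (_  ∷ _) {zero}  {zero}  _ = refl
lookup-injective (x∉ ∷ _) {zero}  {suc j} e = ⊥-elim (All-lookup x∉ (∈-lookup j) e)
lookup-injective (x∉ ∷ _) {suc i} {zero}  e = ⊥-elim (All-lookup x∉ (∈-lookup i) (sym e))
lookup-injective (_  ∷ u) {suc i} {suc j} e = cong suc (lookup-injective u e)

record Embedding (h : A → B) (xs : List A) (ys : List B) : Set where
  constructor embedding
  field
    φ        : Fin (length xs) → Fin (length ys)
    φ-inj    : Injective _≡_ _≡_ φ
    φ-lookup : ∀ i → List.lookup ys (φ i) ≡ h (List.lookup xs i)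

unique⇒embedding : ∀ {h : A → B} {xs ys} → Unique xs → Injective _≡_ _≡_ h →
                   (∀ {x} → x ∈ xs → h x ∈ ys) → Embedding h xs ys
unique⇒embedding {h = h} {xs} {ys} xs-unique h-inj xs⇒ys = embedding φ φ-inj φ-lookup
  where
  φ : Fin (length xs) → Fin (length ys)
  φ i = index (xs⇒ys (∈-lookup i))

  φ-lookup : ∀ i → List.lookup ys (φ i) ≡ h (List.lookup xs i)
  φ-lookup i = sym (lookup-index (xs⇒ys (∈-lookup i)))

  φ-inj : Injective _≡_ _≡_ φ
  φ-inj {i} {j} φi≡φj = lookup-injective xs-unique (h-inj (begin
    h (List.lookup xs i)  ≡⟨ sym (φ-lookup i) ⟩
    List.lookup ys (φ i)  ≡⟨ cong (List.lookup ys) φi≡φj ⟩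
    List.lookup ys (φ j)  ≡⟨ φ-lookup j ⟩
    h (List.lookup xs j)  ∎))
    where open ≡-Reasoning

embedding⇒≤M : ∀ {h : A → B} {xs ys} (F : A → Vecℚ m) (F' : B → Vecℚ m) →
               Embedding h xs ys → (∀ x → F x ≤V F' (h x)) → map F xs ≤M map F' ys
embedding⇒≤M {h = h} {xs} {ys} F F' (embedding φ φ-inj φ-lookup) F≤F'∘h = ψ , ψ-inj , ψ-≤
  where
  to : Fin (length (map F xs)) → Fin (length xs)
  to = cast (length-map F xs)

  from : Fin (length ys) → Fin (length (map F' ys))
  from = cast (sym (length-map F' ys))

  ψ : Fin (length (map F xs)) → Fin (length (map F' ys))
  ψ = from ∘ φ ∘ to

  ψ-inj : Injective _≡_ _≡_ ψ
  ψ-inj = injective _≡_ _≡_ _≡_ (cast-injective (length-map F xs))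
            (injective _≡_ _≡_ _≡_ φ-inj (cast-injective (sym (length-map F' ys))))

  ψ-lookup : ∀ i → List.lookup (map F' ys) (ψ i) ≡ F' (h (List.lookup xs (to i)))
  ψ-lookup i = begin
    List.lookup (map F' ys) (from (φ (to i)))
      ≡⟨ lookup-map F' ys _ ⟩
    F' (List.lookup ys (cast (length-map F' ys) (from (φ (to i)))))
      ≡⟨ cong (F' ∘ List.lookup ys) (cast-involutive (length-map F' ys) _ (φ (to i))) ⟩
    F' (List.lookup ys (φ (to i)))
      ≡⟨ cong F' (φ-lookup (to i)) ⟩
    F' (h (List.lookup xs (to i)))
      ∎
    where open ≡-Reasoning

  ψ-≤ : ∀ i → List.lookup (map F xs) i ≤V List.lookup (map F' ys) (ψ i)
  ψ-≤ i = subst₂ _≤V_ (sym (lookup-map F xs i)) (sym (ψ-lookup i)) (F≤F'∘h _)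

module _ {k} (e : Fin k → Fin k → Bool) {v w : Fin k} where

  ∈-neighbours⁺ : e v w ≡ true → w ∈ neighbours e v
  ∈-neighbours⁺ evw = ∈-filter⁺ (T? ∘ e v) (∈-allFin w) (Equivalence.from T-≡ evw)

  ∈-neighbours⁻ : w ∈ neighbours e v → e v w ≡ true
  ∈-neighbours⁻ w∈ = Equivalence.to T-≡ (proj₂ (∈-filter⁻ (T? ∘ e v) {xs = allFin k} w∈))

neighbours-unique : ∀ {k} (e : Fin k → Fin k → Bool) v → Unique (neighbours e v)
neighbours-unique {k} e v = filter⁺ (T? ∘ e v) (allFin⁺ k)

module _ {d} {G G' : Graph d} {h : Fin (n G) → Fin (n G')}
         (h-adj : ∀ u w → adj G u w ≡ true → adj G' (h u) (h w) ≡ true)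
         (h-inj : Injective _≡_ _≡_ h) where

  neighbours-embedding : ∀ u → Embedding h (neighbours (adj G) u) (neighbours (adj G') (h u))
  neighbours-embedding u = unique⇒embedding (neighbours-unique (adj G) u) h-inj
                             (∈-neighbours⁺ (adj G') ∘ h-adj u _ ∘ ∈-neighbours⁻ (adj G))

  runLayer-mono : ∀ {l : Layer m k} {f f'} → MonoLayer l → (∀ u → f u ≤V f' (h u)) →
                  ∀ u → runLayer G l f u ≤V runLayer G' l f' (h u)
  runLayer-mono {f = f} {f'} (agg-mono , comb-mono) f≤f'∘h u =
    comb-mono _ _ _ _ (f≤f'∘h u)
      (agg-mono (map f (neighbours (adj G) u)) (map f' (neighbours (adj G') (h u)))
        (embedding⇒≤M f f' (neighbours-embedding u) (f≤f'∘h ∘ _)))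

  runLayers-mono : ∀ {ls : Layers m k} {f f'} → MonoLayers ls → (∀ u → f u ≤V f' (h u)) →
                   ∀ u → runLayers G ls f u ≤V runLayers G' ls f' (h u)
  runLayers-mono {ls = []}     _                  f≤f'∘h = f≤f'∘h
  runLayers-mono {ls = l ∷ ls} (l-mono , ls-mono) f≤f'∘h =
    runLayers-mono {ls = ls} ls-mono (runLayer-mono {l = l} l-mono f≤f'∘h)

initFeat-mono : ∀ {d} (G G' : Graph d) {h : Fin (n G) → Fin (n G')} →
                (∀ u i → lookup (label G u) i ≡ true → lookup (label G' (h u)) i ≡ true) →
                ∀ u → initFeat G u ≤V initFeat G' (h u)
initFeat-mono G G' {h} h-label u i =
  subst₂ _≤ℚ_ (sym (Vec.lookup-map i bit (label G u))) (sym (Vec.lookup-map i bit (label G' (h u))))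
    (bit-mono (≡true⇒≤𝔹 (h-label u i)))

monotonic-preserved-by-injHom : ∀ {d} (N : GNN d) → Monotonic N →
  ∀ (G G' : Graph d) (v : Fin (n G)) (v' : Fin (n G')) →
  InjHom G G' v v' → eval N G v ≡ true → eval N G' v' ≡ true
monotonic-preserved-by-injHom N (layers-mono , cls-mono) G G' v _ (h , (refl , h-adj , h-label) , h-inj) =
  ≤𝔹-true (cls-mono _ _ (runLayers-mono h-adj h-inj layers-mono (initFeat-mono G G' h-label) v))

neighboursAtLeast : ℕ → Layer m 1
neighboursAtLeast t = record
  { a        = 1
  ; agg      = λ xs → bit (does (t ≤ℕ? length xs)) ∷ []
  ; agg-perm = λ xs ys xs↭ys → cong (λ l → bit (does (t ≤ℕ? l)) ∷ []) (↭-length xs↭ys)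
  ; comb     = λ _ y → y
  }

neighboursAtLeast-mono : ∀ t → MonoLayer (neighboursAtLeast {m} t)
neighboursAtLeast-mono t = agg-mono , λ _ _ _ _ _ y≤y' → y≤y'
  where
  agg-mono : ∀ xs ys → xs ≤M ys → (bit (does (t ≤ℕ? length xs)) ∷ []) ≤V (bit (does (t ≤ℕ? length ys)) ∷ [])
  agg-mono xs ys (f , f-inj , _) zero =
    bit-mono (does-mono (t ≤ℕ? length xs) (t ≤ℕ? length ys) (λ t≤ → ≤ℕ-trans t≤ (injective⇒≤ f-inj)))

degreeAtLeast : ∀ {d} → ℕ → GNN d
degreeAtLeast t = record
  { out    = 1
  ; layers = neighboursAtLeast t ∷ []
  ; cls    = λ x → does (1ℚ ≤ℚ? lookup x zero)
  }

degreeAtLeast-monotonic : ∀ {d} t → Monotonic (degreeAtLeast {d} t)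
degreeAtLeast-monotonic t =
  (neighboursAtLeast-mono t , tt) ,
  λ x y x≤y → does-mono (1ℚ ≤ℚ? lookup x zero) (1ℚ ≤ℚ? lookup y zero) (λ 1≤x → ≤ℚ-trans 1≤x (x≤y zero))

starAdj : ∀ {k} → Fin (suc k) → Fin (suc k) → Bool
starAdj zero    (suc _) = true
starAdj (suc _) zero    = true
starAdj _       _       = false

star : ℕ → Graph 0
star k = record
  { n      = suc k
  ; adj    = starAdj
  ; sym    = starAdj-sym
  ; irrefl = starAdj-irrefl
  ; label  = λ _ → []
  }
  where
  starAdj-sym : ∀ u w → starAdj {k} u w ≡ starAdj w u
  starAdj-sym zero    zero    = refl
  starAdj-sym zero    (suc _) = refl
  starAdj-sym (suc _) zero    = refl
  starAdj-sym (suc _) (suc _) = refl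

  starAdj-irrefl : ∀ u → starAdj {k} u u ≡ false
  starAdj-irrefl zero    = refl
  starAdj-irrefl (suc _) = refl

collapseLeaves : ∀ {k} → Fin (suc k) → Fin 2
collapseLeaves zero    = zero
collapseLeaves (suc _) = suc zero

collapseLeaves-hom : ∀ k → Hom (star k) (star 1) zero zero
collapseLeaves-hom k = collapseLeaves , refl , adj-preserved , λ _ ()
  where
  adj-preserved : ∀ u w → starAdj {k} u w ≡ true → starAdj (collapseLeaves u) (collapseLeaves w) ≡ true
  adj-preserved zero    (suc _) _ = refl
  adj-preserved (suc _) zero    _ = refl

theorem5p3 :
    (∀ {d} (N : GNN d) → Monotonic N →
      ∀ (G G' : Graph d) (v : Fin (n G)) (v' : Fin (n G')) →
      InjHom G G' v v' → eval N G v ≡ true → eval N G' v' ≡ true)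
    ×
    Σ ℕ (λ d → Σ (GNN d) (λ N → Monotonic N ×
      Σ (Graph d) (λ G → Σ (Graph d) (λ G' →
        Σ (Fin (n G)) (λ v → Σ (Fin (n G')) (λ v' →
          Hom G G' v v' × eval N G v ≡ true × eval N G' v' ≡ false))))))
theorem5p3 =
  monotonic-preserved-by-injHom ,
  0 , degreeAtLeast 2 , degreeAtLeast-monotonic 2 ,
  star 2 , star 1 , zero , zero , collapseLeaves-hom 2 , refl , refl
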